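{- Let $x,v$ be positive integers with $xv\ge2$. Let $\lambda=(x,\dots,x)$ with $v$ occurrences of $x$, and $\lambda'=(v,\dots,v)$ with $x$ occurrences of $v$. Then the posets $P(\lambda)$ and $P(\lambda')$ are isomorphic.
   Context: For $\lambda=(\lambda_1,\dots,\lambda_d)$ positive integers summing to $n$, $\Delta_\lambda=\mathrm{conv}(e_1,\dots,e_d,\lambda)\subset\mathbb{R}^d$ ($e_i$ standard basis vectors), with fundamental parallelepiped $\Pi_\lambda=\{\sum_{i=1}^d\gamma_i(1,e_i)+\gamma_{d+1}(1,\lambda): 0\le\gamma_i<1\}$. The poset $P(\lambda)$ is $\Pi_\lambda\cap\mathbb{Z}^{d+1}$ with $\sigma\preceq\mu$ iff $\mu-\sigma\in\Pi_\lambda\cap\mathbb{Z}^{d+1}$. -}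

module Defs where

open import Data.Nat as ℕ using (ℕ)
open import Data.Integer as ℤ using (ℤ)
open import Data.Rational as ℚ using (ℚ; 0ℚ; 1ℚ)
open import Data.Fin using (Fin; _≟_)
open import Data.Vec using (Vec; []; _∷_; _∷ʳ_; map; zipWith; foldr; replicate; tabulate; allFin)
open import Data.Vec.Relation.Unary.All using (All)
open import Data.Product using (Σ; _×_)
open import Relation.Binary.PropositionalEquality using (_≡_)
open import Relation.Nullary.Decidable using (does)
open import Data.Bool using (if_then_else_)

Point : ℕ → Set
Point d = Vec ℤ (ℕ.suc d)

toℚ : ℤ → ℚ
toℚ z = z ℚ./ 1

e : {d : ℕ} → Fin d → Vec ℚ d
e i = tabulate (λ j → if does (i ≟ j) then 1ℚ else 0ℚ)

-- generators (1,e_1),…,(1,e_d),(1,λ) of the cone over Δ_λ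
gens : {d : ℕ} → Vec ℕ d → Vec (Vec ℚ (ℕ.suc d)) (ℕ.suc d)
gens {d} lam = map (λ i → 1ℚ ∷ e i) (allFin d) ∷ʳ (1ℚ ∷ map (λ k → toℚ (ℤ.+ k)) lam)

lincomb : {m k : ℕ} → Vec ℚ k → Vec (Vec ℚ m) k → Vec ℚ m
lincomb {m} γ ws = foldr _ (zipWith ℚ._+_) (replicate m 0ℚ) (zipWith (λ c w → map (c ℚ.*_) w) γ ws)

InΠ : {d : ℕ} → Vec ℕ d → Point d → Set
InΠ lam p = Σ (Vec ℚ _) λ γ →
  All (λ c → (0ℚ ℚ.≤ c) × (c ℚ.< 1ℚ)) γ × (map toℚ p ≡ lincomb γ (gens lam))

_⪯[_]_ : {d : ℕ} → Point d → Vec ℕ d → Point d → Set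
σ ⪯[ lam ] μ = InΠ lam (zipWith ℤ._-_ μ σ)

record PosetIso {d d' : ℕ} (lam : Vec ℕ d) (lam' : Vec ℕ d') : Set where
  field
    to      : Point d → Point d'
    from    : Point d' → Point d
    to-mem  : ∀ p → InΠ lam p → InΠ lam' (to p)
    from-mem : ∀ q → InΠ lam' q → InΠ lam (from q)
    from-to : ∀ p → InΠ lam p → from (to p) ≡ p
    to-from : ∀ q → InΠ lam' q → to (from q) ≡ q
    mono    : ∀ p q → InΠ lam p → InΠ lam q → p ⪯[ lam ] q → to p ⪯[ lam' ] to q
    reflect : ∀ p q → InΠ lam p → InΠ lam q → to p ⪯[ lam' ] to q → p ⪯[ lam ] q

-- A lattice point of Π_λ for λ = (y,…,y) (n entries) is Σ γᵢ(1,eᵢ) + g(1,λ); its last n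
-- coordinates γᵢ + g y are integers and the γᵢ lie in [0,1), so all γᵢ equal one t, and the
-- lattice points are exactly (n t + g, t + y g, …, t + y g) with t, g ∈ [0,1).  This
-- description is symmetric under (n, y, t, g) ↦ (y, n, g, t), so (a, c, …, c) ↦ (c, a, …, a)
-- maps P(λ) onto P(λ'); it commutes with differences, hence preserves and reflects the order.
module Submission where

open import Data.Nat using (ℕ; zero; suc; _*_; _≤_; _<_)
open import Data.Integer as ℤ using (ℤ; +_)
import Data.Integer.Properties as ℤP
open import Data.Rational as ℚ using (ℚ; 0ℚ; 1ℚ)
import Data.Rational.Properties as ℚP
import Data.Rational.Unnormalised as ℚᵘ
import Data.Rational.Unnormalised.Properties as ℚᵘP
open import Data.Rational.Solver using (module +-*-Solver)
open import Algebra.Properties.Group ℚP.+-0-group using (∙-cancelʳ)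
open import Data.Fin using (Fin; zero; suc; _≟_)
open import Data.Vec using (Vec; []; _∷_; _∷ʳ_; lookup; map; zipWith; replicate; tabulate; allFin; initLast)
open import Data.Vec.Properties
  using (lookup-zipWith; lookup-map; lookup-replicate; lookup∘tabulate; map-∷ʳ; map-∘; tabulate-allFin; tabulate-cong; zipWith-replicate)
open import Data.Vec.Relation.Binary.Pointwise.Extensional using (ext; Pointwise-≡⇒≡)
open import Data.Vec.Relation.Unary.All using (All; []; _∷_)
open import Data.Vec.Relation.Unary.All.Properties using (lookup⁺)
open import Data.Product using (_×_; _,_; ∃₂)
open import Data.Bool using (if_then_else_)
open import Data.Empty using (⊥; ⊥-elim)
open import Relation.Nullary.Decidable using (does)
open import Relation.Binary using (tri<; tri≈; tri>)
open import Relation.Binary.PropositionalEquality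
open import Defs

open +-*-Solver

≡-replicate : ∀ {A : Set} {n} (xs : Vec A n) {c : A} → (∀ i → lookup xs i ≡ c) → xs ≡ replicate n c
≡-replicate xs {c} h = Pointwise-≡⇒≡ (ext (λ i → trans (h i) (sym (lookup-replicate i c))))

All-replicate⁺ : ∀ {A : Set} {P : A → Set} n {x} → P x → All P (replicate n x)
All-replicate⁺ zero    px = []
All-replicate⁺ (suc n) px = px ∷ All-replicate⁺ n px

All-∷ʳ⁺ : ∀ {A : Set} {P : A → Set} {n} {xs : Vec A n} {x} → All P xs → P x → All P (xs ∷ʳ x)
All-∷ʳ⁺ []         px = px ∷ []
All-∷ʳ⁺ (py ∷ pxs) px = py ∷ All-∷ʳ⁺ pxs px

All-∷ʳ⁻ : ∀ {A : Set} {P : A → Set} {n} (xs : Vec A n) {x} → All P (xs ∷ʳ x) → All P xs × P x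
All-∷ʳ⁻ []       (px ∷ []) = [] , px
All-∷ʳ⁻ (_ ∷ xs) (py ∷ pxs) with All-∷ʳ⁻ xs pxs
... | pys , px = py ∷ pys , px

toℚᵘ-toℚ : ∀ z → ℚ.toℚᵘ (toℚ z) ℚᵘ.≃ ℚᵘ.mkℚᵘ z 0
toℚᵘ-toℚ z = ℚP.toℚᵘ-fromℚᵘ (ℚᵘ.mkℚᵘ z 0)

toℚ-homo-+ : ∀ m n → toℚ (m ℤ.+ n) ≡ toℚ m ℚ.+ toℚ n
toℚ-homo-+ m n = ℚP.toℚᵘ-injective (ℚᵘP.≃-trans (toℚᵘ-toℚ (m ℤ.+ n)) (ℚᵘP.≃-trans sum
  (ℚᵘP.≃-sym (ℚᵘP.≃-trans (ℚP.toℚᵘ-homo-+ (toℚ m) (toℚ n)) (ℚᵘP.+-cong (toℚᵘ-toℚ m) (toℚᵘ-toℚ n))))))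
  where
  sum : ℚᵘ.mkℚᵘ (m ℤ.+ n) 0 ℚᵘ.≃ ℚᵘ.mkℚᵘ m 0 ℚᵘ.+ ℚᵘ.mkℚᵘ n 0
  sum = ℚᵘ.*≡* (cong (ℤ._* ℤ.1ℤ) (sym (cong₂ ℤ._+_ (ℤP.*-identityʳ m) (ℤP.*-identityʳ n))))

toℚ-mono-≤ : ∀ {m n} → m ℤ.≤ n → toℚ m ℚ.≤ toℚ n
toℚ-mono-≤ {m} {n} m≤n = ℚP.toℚᵘ-cancel-≤
  (ℚᵘP.≤-respˡ-≃ (ℚᵘP.≃-sym (toℚᵘ-toℚ m)) (ℚᵘP.≤-respʳ-≃ (ℚᵘP.≃-sym (toℚᵘ-toℚ n))
    (ℚᵘ.*≤* (subst₂ ℤ._≤_ (sym (ℤP.*-identityʳ m)) (sym (ℤP.*-identityʳ n)) m≤n))))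

InUnitInterval : ℚ → Set
InUnitInterval c = (0ℚ ℚ.≤ c) × (c ℚ.< 1ℚ)

offset-<-impossible : ∀ {m n s t} G → m ℤ.< n → toℚ m ≡ s ℚ.+ G → toℚ n ≡ t ℚ.+ G →
                      0ℚ ℚ.≤ s → t ℚ.< 1ℚ → ⊥
offset-<-impossible {m} {n} {s} {t} G m<n m≡s+G n≡t+G 0≤s t<1 = ℚP.<-irrefl refl (begin-strict
  t ℚ.+ G          <⟨ ℚP.+-monoˡ-< G (ℚP.<-≤-trans t<1 1≤1+s) ⟩
  1ℚ ℚ.+ s ℚ.+ G   ≡⟨ trans (ℚP.+-assoc 1ℚ s G) (cong (1ℚ ℚ.+_) (sym m≡s+G)) ⟩
  1ℚ ℚ.+ toℚ m     ≡⟨ sym (toℚ-homo-+ ℤ.1ℤ m) ⟩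
  toℚ (ℤ.suc m)    ≤⟨ toℚ-mono-≤ (ℤP.i<j⇒suc[i]≤j m<n) ⟩
  toℚ n            ≡⟨ n≡t+G ⟩
  t ℚ.+ G          ∎)
  where
  open ℚP.≤-Reasoning
  1≤1+s : 1ℚ ℚ.≤ 1ℚ ℚ.+ s
  1≤1+s = subst (ℚ._≤ 1ℚ ℚ.+ s) (ℚP.+-identityʳ 1ℚ) (ℚP.+-monoʳ-≤ 1ℚ 0≤s)

unitInterval-offset-injective : ∀ {m n s t} G → InUnitInterval s → InUnitInterval t →
  toℚ m ≡ s ℚ.+ G → toℚ n ≡ t ℚ.+ G → m ≡ n
unitInterval-offset-injective {m} {n} G (0≤s , s<1) (0≤t , t<1) m≡s+G n≡t+G with ℤP.<-cmp m n
... | tri< m<n _ _ = ⊥-elim (offset-<-impossible G m<n m≡s+G n≡t+G 0≤s t<1)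
... | tri≈ _ m≡n _ = m≡n
... | tri> _ _ n<m = ⊥-elim (offset-<-impossible G n<m n≡t+G m≡s+G 0≤t s<1)

dot : ∀ {k} → Vec ℚ k → Vec ℚ k → ℚ
dot []      []       = 0ℚ
dot (c ∷ γ) (u ∷ us) = c ℚ.* u ℚ.+ dot γ us

dot-∷ʳ : ∀ {k} (γ us : Vec ℚ k) g u → dot (γ ∷ʳ g) (us ∷ʳ u) ≡ dot γ us ℚ.+ g ℚ.* u
dot-∷ʳ []      []        g u = ℚP.+-comm (g ℚ.* u) 0ℚ
dot-∷ʳ (c ∷ γ) (u′ ∷ us) g u =
  trans (cong (c ℚ.* u′ ℚ.+_) (dot-∷ʳ γ us g u)) (sym (ℚP.+-assoc (c ℚ.* u′) (dot γ us) (g ℚ.* u)))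

dot-zeros : ∀ {k} (γ : Vec ℚ k) → dot γ (tabulate (λ _ → 0ℚ)) ≡ 0ℚ
dot-zeros []      = refl
dot-zeros (c ∷ γ) = trans (cong₂ ℚ._+_ (ℚP.*-zeroʳ c) (dot-zeros γ)) (ℚP.+-identityˡ 0ℚ)

dot-indicator : ∀ {k} (γ : Vec ℚ k) i → dot γ (tabulate (λ j → if does (j ≟ i) then 1ℚ else 0ℚ)) ≡ lookup γ i
dot-indicator (c ∷ γ) zero    = trans (cong₂ ℚ._+_ (ℚP.*-identityʳ c) (dot-zeros γ)) (ℚP.+-identityʳ c)
dot-indicator (c ∷ γ) (suc i) = trans (cong₂ ℚ._+_ (ℚP.*-zeroʳ c) (dot-indicator γ i)) (ℚP.+-identityˡ _)

dot-replicate-ones : ∀ n t → dot (replicate n t) (tabulate (λ _ → 1ℚ)) ≡ toℚ (+ n) ℚ.* t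
dot-replicate-ones zero    t = sym (ℚP.*-zeroˡ t)
dot-replicate-ones (suc n) t = begin
  t ℚ.* 1ℚ ℚ.+ dot (replicate n t) (tabulate (λ _ → 1ℚ)) ≡⟨ cong (t ℚ.* 1ℚ ℚ.+_) (dot-replicate-ones n t) ⟩
  t ℚ.* 1ℚ ℚ.+ toℚ (+ n) ℚ.* t                          ≡⟨ solve 2 (λ t n → t :* con 1ℚ :+ n :* t := (con 1ℚ :+ n) :* t) refl t (toℚ (+ n)) ⟩
  (1ℚ ℚ.+ toℚ (+ n)) ℚ.* t                              ≡⟨ cong (ℚ._* t) (sym (toℚ-homo-+ ℤ.1ℤ (+ n))) ⟩
  toℚ (+ suc n) ℚ.* t                                   ∎
  where open ≡-Reasoning

lookup-lincomb : ∀ {m k} (γ : Vec ℚ k) (ws : Vec (Vec ℚ m) k) j →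
  lookup (lincomb γ ws) j ≡ dot γ (map (λ w → lookup w j) ws)
lookup-lincomb []      []       j = lookup-replicate j 0ℚ
lookup-lincomb (c ∷ γ) (w ∷ ws) j =
  trans (lookup-zipWith ℚ._+_ j (map (c ℚ.*_) w) (lincomb γ ws))
        (cong₂ ℚ._+_ (lookup-map j (c ℚ.*_) w) (lookup-lincomb γ ws j))

lookup-lincomb-gens : ∀ {d} (lam : Vec ℕ d) γ g j →
  lookup (lincomb (γ ∷ʳ g) (gens lam)) j ≡
  dot γ (tabulate (λ i → lookup (1ℚ ∷ e i) j)) ℚ.+ g ℚ.* lookup (1ℚ ∷ map (λ k → toℚ (+ k)) lam) j
lookup-lincomb-gens {d} lam γ g j = begin
  lookup (lincomb (γ ∷ʳ g) (gens lam)) j            ≡⟨ lookup-lincomb (γ ∷ʳ g) (gens lam) j ⟩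
  dot (γ ∷ʳ g) (map (λ w → lookup w j) (gens lam))  ≡⟨ cong (dot (γ ∷ʳ g)) (trans (map-∷ʳ _ λ′ _) (cong (_∷ʳ lookup λ′ j) column)) ⟩
  dot (γ ∷ʳ g) (tabulate (λ i → lookup (1ℚ ∷ e i) j) ∷ʳ lookup λ′ j)  ≡⟨ dot-∷ʳ γ _ g (lookup λ′ j) ⟩
  dot γ (tabulate (λ i → lookup (1ℚ ∷ e i) j)) ℚ.+ g ℚ.* lookup λ′ j  ∎
  where
  open ≡-Reasoning
  λ′ : Vec ℚ (suc d)
  λ′ = 1ℚ ∷ map (λ k → toℚ (+ k)) lam
  column : map (λ w → lookup w j) (map (λ i → 1ℚ ∷ e i) (allFin d)) ≡ tabulate (λ i → lookup (1ℚ ∷ e i) j)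
  column = trans (sym (map-∘ _ _ (allFin d))) (sym (tabulate-allFin _))

lincomb-gens-head : ∀ {d} (lam : Vec ℕ d) γ g →
  lookup (lincomb (γ ∷ʳ g) (gens lam)) zero ≡ dot γ (tabulate (λ _ → 1ℚ)) ℚ.+ g
lincomb-gens-head lam γ g =
  trans (lookup-lincomb-gens lam γ g zero) (cong (dot γ (tabulate (λ _ → 1ℚ)) ℚ.+_) (ℚP.*-identityʳ g))

lincomb-gens-tail : ∀ {d} (lam : Vec ℕ d) γ g i →
  lookup (lincomb (γ ∷ʳ g) (gens lam)) (suc i) ≡ lookup γ i ℚ.+ g ℚ.* toℚ (+ lookup lam i)
lincomb-gens-tail lam γ g i = trans (lookup-lincomb-gens lam γ g (suc i))
  (cong₂ (λ u l → u ℚ.+ g ℚ.* l)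
    (trans (cong (dot γ) (tabulate-cong (λ k → lookup∘tabulate _ i))) (dot-indicator γ i))
    (lookup-map i (λ k → toℚ (+ k)) lam))

diag : ∀ {n} → ℤ → ℤ → Point n
diag {n} a c = a ∷ replicate n c

diag-sub : ∀ {n} a c a′ c′ → zipWith ℤ._-_ (diag {n} a′ c′) (diag a c) ≡ diag (a′ ℤ.- a) (c′ ℤ.- c)
diag-sub a c a′ c′ = cong (a′ ℤ.- a ∷_) (zipWith-replicate ℤ._-_ c′ c)

record ΠCoordinates (n y : ℕ) (a c : ℤ) : Set where
  field
    t g     : ℚ
    t-unit  : InUnitInterval t
    g-unit  : InUnitInterval g
    head-eq : toℚ a ≡ toℚ (+ n) ℚ.* t ℚ.+ g
    tail-eq : toℚ c ≡ toℚ (+ y) ℚ.* g ℚ.+ t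

ΠCoordinates-swap : ∀ {n y a c} → ΠCoordinates n y a c → ΠCoordinates y n c a
ΠCoordinates-swap r = record
  { t = g ; g = t ; t-unit = g-unit ; g-unit = t-unit ; head-eq = tail-eq ; tail-eq = head-eq }
  where open ΠCoordinates r

diag-∈Π : ∀ {n y a c} → ΠCoordinates n y a c → InΠ (replicate n y) (diag a c)
diag-∈Π {n} {y} {a} {c} r =
  replicate n t ∷ʳ g , All-∷ʳ⁺ (All-replicate⁺ n t-unit) g-unit , Pointwise-≡⇒≡ (ext coordinate)
  where
  open ΠCoordinates r
  open ≡-Reasoning
  coordinate : ∀ j → lookup (map toℚ (diag a c)) j ≡ lookup (lincomb (replicate n t ∷ʳ g) (gens (replicate n y))) j
  coordinate zero = begin
    toℚ a                                                  ≡⟨ head-eq ⟩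
    toℚ (+ n) ℚ.* t ℚ.+ g                                  ≡⟨ cong (ℚ._+ g) (sym (dot-replicate-ones n t)) ⟩
    dot (replicate n t) (tabulate (λ _ → 1ℚ)) ℚ.+ g        ≡⟨ sym (lincomb-gens-head (replicate n y) (replicate n t) g) ⟩
    lookup (lincomb (replicate n t ∷ʳ g) (gens (replicate n y))) zero ∎
  coordinate (suc i) = begin
    lookup (map toℚ (replicate n c)) i                     ≡⟨ lookup-map i toℚ (replicate n c) ⟩
    toℚ (lookup (replicate n c) i)                         ≡⟨ cong toℚ (lookup-replicate i c) ⟩
    toℚ c                                                  ≡⟨ tail-eq ⟩
    toℚ (+ y) ℚ.* g ℚ.+ t                                  ≡⟨ solve 3 (λ y g t → y :* g :+ t := t :+ g :* y) refl (toℚ (+ y)) g t ⟩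
    t ℚ.+ g ℚ.* toℚ (+ y)                                  ≡⟨ sym (cong₂ (λ u l → u ℚ.+ g ℚ.* toℚ (+ l)) (lookup-replicate i t) (lookup-replicate i y)) ⟩
    lookup (replicate n t) i ℚ.+ g ℚ.* toℚ (+ lookup (replicate n y) i) ≡⟨ sym (lincomb-gens-tail (replicate n y) (replicate n t) g i) ⟩
    lookup (lincomb (replicate n t ∷ʳ g) (gens (replicate n y))) (suc i) ∎

∈Π-diag : ∀ {n y} (p : Point (suc n)) → InΠ (replicate (suc n) y) p →
          ∃₂ λ a c → p ≡ diag a c × ΠCoordinates (suc n) y a c
∈Π-diag {n} {y} (a ∷ cs) (γ , γ-unit , p≡Σ) with initLast γ
... | γ₀ , g , refl with All-∷ʳ⁻ γ₀ γ-unit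
... | γ₀-unit , g-unit = a , c , cong (a ∷_) cs≡c , record
  { t = t ; g = g ; t-unit = lookup⁺ γ₀-unit zero ; g-unit = g-unit ; head-eq = head-eq
  ; tail-eq = trans (tail zero) (ℚP.+-comm t G) }
  where
  open ≡-Reasoning
  c : ℤ
  c = lookup cs zero
  t G : ℚ
  t = lookup γ₀ zero
  G = toℚ (+ y) ℚ.* g
  tail : ∀ i → toℚ (lookup cs i) ≡ lookup γ₀ i ℚ.+ G
  tail i = begin
    toℚ (lookup cs i)                     ≡⟨ sym (lookup-map i toℚ cs) ⟩
    lookup (map toℚ cs) i                 ≡⟨ cong (λ w → lookup w (suc i)) p≡Σ ⟩
    lookup (lincomb (γ₀ ∷ʳ g) (gens (replicate (suc n) y))) (suc i) ≡⟨ lincomb-gens-tail (replicate (suc n) y) γ₀ g i ⟩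
    lookup γ₀ i ℚ.+ g ℚ.* toℚ (+ lookup (replicate (suc n) y) i)  ≡⟨ cong (λ l → lookup γ₀ i ℚ.+ g ℚ.* toℚ (+ l)) (lookup-replicate i y) ⟩
    lookup γ₀ i ℚ.+ g ℚ.* toℚ (+ y)       ≡⟨ cong (lookup γ₀ i ℚ.+_) (ℚP.*-comm g (toℚ (+ y))) ⟩
    lookup γ₀ i ℚ.+ G                     ∎
  cs-const : ∀ i → lookup cs i ≡ c
  cs-const i = unitInterval-offset-injective G (lookup⁺ γ₀-unit i) (lookup⁺ γ₀-unit zero) (tail i) (tail zero)
  γ₀-const : ∀ i → lookup γ₀ i ≡ t
  γ₀-const i = ∙-cancelʳ G (lookup γ₀ i) t (trans (sym (tail i)) (trans (cong toℚ (cs-const i)) (tail zero)))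
  cs≡c : cs ≡ replicate (suc n) c
  cs≡c = ≡-replicate cs cs-const
  head-eq : toℚ a ≡ toℚ (+ suc n) ℚ.* t ℚ.+ g
  head-eq = begin
    toℚ a                                                 ≡⟨ cong (λ w → lookup w zero) p≡Σ ⟩
    lookup (lincomb (γ₀ ∷ʳ g) (gens (replicate (suc n) y))) zero ≡⟨ lincomb-gens-head (replicate (suc n) y) γ₀ g ⟩
    dot γ₀ (tabulate (λ _ → 1ℚ)) ℚ.+ g                    ≡⟨ cong (λ γ′ → dot γ′ (tabulate (λ _ → 1ℚ)) ℚ.+ g) (≡-replicate γ₀ γ₀-const) ⟩
    dot (replicate (suc n) t) (tabulate (λ _ → 1ℚ)) ℚ.+ g ≡⟨ cong (ℚ._+ g) (dot-replicate-ones (suc n) t) ⟩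
    toℚ (+ suc n) ℚ.* t ℚ.+ g                             ∎

swap : ∀ {n} m → Point (suc n) → Point m
swap m (a ∷ c ∷ _) = diag c a

swap-∈Π : ∀ {n y} (p : Point (suc n)) → InΠ (replicate (suc n) y) p →
          InΠ (replicate y (suc n)) (swap y p)
swap-∈Π p p∈Π with ∈Π-diag p p∈Π
... | a , c , refl , coordinates = diag-∈Π (ΠCoordinates-swap coordinates)

swap-involutive : ∀ {n m} (p : Point (suc n)) → InΠ (replicate (suc n) (suc m)) p →
                  swap (suc n) (swap (suc m) p) ≡ p
swap-involutive p p∈Π with ∈Π-diag p p∈Π
... | a , c , refl , _ = refl

swap-mono : ∀ {n y} (p q : Point (suc n)) → InΠ (replicate (suc n) y) p → InΠ (replicate (suc n) y) q →
            p ⪯[ replicate (suc n) y ] q → swap y p ⪯[ replicate y (suc n) ] swap y q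
swap-mono {n} {y} p q p∈Π q∈Π p⪯q with ∈Π-diag p p∈Π | ∈Π-diag q q∈Π
... | a , c , refl , _ | a′ , c′ , refl , _ =
  subst (InΠ (replicate y (suc n))) (sym (diag-sub c a c′ a′))
    (swap-∈Π (diag (a′ ℤ.- a) (c′ ℤ.- c)) (subst (InΠ (replicate (suc n) y)) (diag-sub a c a′ c′) p⪯q))

swap-reflect : ∀ {n m} (p q : Point (suc n)) → InΠ (replicate (suc n) (suc m)) p → InΠ (replicate (suc n) (suc m)) q →
               swap (suc m) p ⪯[ replicate (suc m) (suc n) ] swap (suc m) q → p ⪯[ replicate (suc n) (suc m) ] q
swap-reflect {n} {m} p q p∈Π q∈Π swap⪯ =
  subst₂ (_⪯[ replicate (suc n) (suc m) ]_) (swap-involutive p p∈Π) (swap-involutive q q∈Π)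
    (swap-mono (swap _ p) (swap _ q) (swap-∈Π p p∈Π) (swap-∈Π q q∈Π) swap⪯)

corollary4p2 : (x v : ℕ) → 0 < x → 0 < v → 2 ≤ x * v →
    PosetIso (replicate v x) (replicate x v)
corollary4p2 (suc x) (suc v) _ _ _ = record
  { to       = swap (suc x)
  ; from     = swap (suc v)
  ; to-mem   = swap-∈Π
  ; from-mem = swap-∈Π
  ; from-to  = swap-involutive
  ; to-from  = swap-involutive
  ; mono     = swap-mono
  ; reflect  = swap-reflect
  }
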